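{- Let $B$ be a simple graph. If $B$ has a full $B$-queue, then $\operatorname{cfan}(B)\leq 0$.
   Context: For a graph $J$ (here simple), $\mu_J(x,y)$ is the number of edges of $J$ joining $x$ and $y$; $d_J(v)$ is the degree of $v$; $N_J(x)$ is the neighbourhood of $x$. For a graph $H$, a subgraph $K\subseteq H$ and an ordered pair $(x,y)$ with $xy\in E(K)$, $\operatorname{cdeg}_{H,K}(x,y)$ is the smallest nonnegative integer $l$ such that for all $Z\subseteq N_K(x)$ with $y\in Z$, $\sum_{z\in Z}(d_K(z)-d_H(z)+\mu_K(x,z)-l)\leq 1$; $\operatorname{cfan}(H)=\max_{K\subseteq H,\,E(K)\neq\emptyset}\min\{\operatorname{cdeg}_{H,K}(x,y): xy\in E(K)\}$, with $\operatorname{cfan}(H)=0$ if $H$ is edgeless. A $B$-queue of a simple graph $B$ is a sequence of vertices $(u_1,\ldots,u_q)$ together with vertex subsets $(S_0,\ldots,S_q)$ such that $S_0=\emptyset$ and for all $i\in\{1,\ldots,q\}$: $S_i=N_B(u_i)\cup\{u_i\}\cup S_{i-1}$; $1\leq|S_i\setminus S_{i-1}|\leq 2$; $u_i\notin\{u_1,\ldots,u_{i-1}\}$; and $|S_i\setminus(S_{i-1}\cup\{u_i\})|\leq 1$. It is full if $S_q=V(B)$. -}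

module Defs where

open import Data.Nat as ℕ using (ℕ; zero; suc; _≤_; _<_)
open import Data.Integer as ℤ using (ℤ; +_; _-_; _+_)
open import Data.Fin using (Fin; _≟_)
open import Data.Fin.Base using ()
open import Data.List using (List; foldr; map; filter; length)
open import Data.List.Base using (allFin)
open import Data.Bool using (Bool; true; false; if_then_else_; _∨_; _∧_; not; T)
open import Data.Product using (Σ; ∃; _×_; _,_)
open import Relation.Nullary using (¬_)
open import Relation.Nullary.Decidable using (⌊_⌋)
open import Relation.Binary.PropositionalEquality using (_≡_; _≢_)

record SimpleGraph (n : ℕ) : Set where
  field
    adj    : Fin n → Fin n → Bool
    sym    : ∀ u v → adj u v ≡ adj v u
    irrefl : ∀ v → adj v v ≡ false
open SimpleGraph public

countV : ∀ {n} → (Fin n → Bool) → ℕ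
countV {n} P = length (filter (λ v → T? (P v)) (allFin n))
  where
  open import Data.Bool.Properties using (T?)

sumℤ : ∀ {n} → (Fin n → ℤ) → ℤ
sumℤ {n} f = foldr _+_ (+ 0) (map f (allFin n))

deg : ∀ {n} → SimpleGraph n → Fin n → ℕ
deg G v = countV (adj G v)

μ : ∀ {n} → SimpleGraph n → Fin n → Fin n → ℕ
μ G x y = if adj G x y then 1 else 0

_⊆G_ : ∀ {n} → SimpleGraph n → SimpleGraph n → Set
K ⊆G H = ∀ u v → adj K u v ≡ true → adj H u v ≡ true

HasEdge : ∀ {n} → SimpleGraph n → Set
HasEdge K = ∃ λ x → ∃ λ y → adj K x y ≡ true

CdegCond : ∀ {n} → SimpleGraph n → SimpleGraph n → Fin n → Fin n → ℕ → Set
CdegCond {n} H K x y l =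
  (Z : Fin n → Bool) →
  (∀ z → Z z ≡ true → adj K x z ≡ true) →
  Z y ≡ true →
  sumℤ (λ z → if Z z
                then (+ deg K z - + deg H z + + μ K x z - + l)
                else + 0) ℤ.≤ + 1

IsCdeg : ∀ {n} → SimpleGraph n → SimpleGraph n → Fin n → Fin n → ℕ → Set
IsCdeg H K x y l = CdegCond H K x y l × (∀ l' → l' < l → ¬ CdegCond H K x y l')

-- cfan(H) ≤ c :  max over K ⊆ H with E(K) ≠ ∅ of min over edges xy of K of cdeg_{H,K}(x,y) is ≤ c,
-- i.e. every such K has an edge (x,y) (ordered) whose cdeg is ≤ c.
-- (If H is edgeless, cfan(H) = 0 and the condition holds vacuously.)
CfanAtMost : ∀ {n} → SimpleGraph n → ℕ → Set
CfanAtMost H c =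
  (K : SimpleGraph _) → K ⊆G H → HasEdge K →
  ∃ λ x → ∃ λ y → adj K x y ≡ true × (∃ λ l → IsCdeg H K x y l × l ≤ c)

-- B-queue (u_1,…,u_q), (S_0,…,S_q); indices 1..q used via ℕ, sets as Boolean predicates.
record Queue {n : ℕ} (B : SimpleGraph n) : Set where
  field
    q : ℕ
    u : ℕ → Fin n
    S : ℕ → Fin n → Bool
    S0     : ∀ v → S 0 v ≡ false
    Sstep  : ∀ i → 1 ≤ i → i ≤ q → ∀ v →
             S i v ≡ (adj B (u i) v ∨ ⌊ u i ≟ v ⌋ ∨ S (ℕ.pred i) v)
    growLo : ∀ i → 1 ≤ i → i ≤ q →
             1 ≤ countV (λ v → S i v ∧ not (S (ℕ.pred i) v))
    growHi : ∀ i → 1 ≤ i → i ≤ q →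
             countV (λ v → S i v ∧ not (S (ℕ.pred i) v)) ≤ 2
    fresh  : ∀ i → 1 ≤ i → i ≤ q → ∀ j → 1 ≤ j → j < i → u j ≢ u i
    extra  : ∀ i → 1 ≤ i → i ≤ q →
             countV (λ v → S i v ∧ not (S (ℕ.pred i) v ∨ ⌊ u i ≟ v ⌋)) ≤ 1
open Queue public

IsFull : ∀ {n} {B : SimpleGraph n} → Queue B → Set
IsFull Q = ∀ v → S Q (q Q) v ≡ true

HasFullQueue : ∀ {n} → SimpleGraph n → Set
HasFullQueue B = Σ (Queue B) IsFull

-- A vertex z with d_K(z) < d_B(z) contributes at most 0 to
-- every cdeg sum with l = 0, and any vertex contributes at most 1; so an edge xy of K has
-- cdeg 0 as soon as every K-neighbour of x other than y is such a deficient vertex. Walk along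
-- the queue while the vertices u_1, u_2, … are isolated in K: every vertex of S_j is then
-- isolated in K or a B-neighbour of some isolated u_i, hence deficient. If u_i is the first
-- vertex with a K-neighbour, its non-deficient K-neighbours lie outside S_{i-1} ∪ {u_i}, and
-- there is at most one of them by the queue axiom. If no u_i has a K-neighbour, fullness makes
-- every non-isolated vertex deficient and any edge of K will do.
module Submission where

open import Defs
open import Data.Nat using (ℕ)

open import Data.Nat as ℕ using (zero; suc; z≤n; s≤s)
import Data.Nat.Properties as ℕP
open import Data.Integer as ℤ using (ℤ; +_; _-_; _+_; _⊖_)
import Data.Integer.Properties as ℤP
open import Data.Fin as F using (Fin; _≟_)
import Data.Fin.Properties as FP
open import Data.List using (foldr; filter; length; tabulate)
import Data.List.Properties as ListP
open import Data.Bool using (Bool; true; false; if_then_else_; _∨_; _∧_; not)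
import Data.Bool.Properties as BoolP
open import Data.Product using (∃; _×_; _,_)
open import Data.Sum using (_⊎_; inj₁; inj₂)
open import Data.Empty using (⊥-elim)
open import Relation.Nullary using (¬_; yes; no; ¬?; _×-dec_)
open import Relation.Nullary.Decidable using (⌊_⌋; decidable-stable)
open import Relation.Binary.PropositionalEquality hiding (sym)
import Relation.Binary.PropositionalEquality as ≡
open import Function using (_∘_; id)

_⊆ᵇ_ : ∀ {n} → (Fin n → Bool) → (Fin n → Bool) → Set
P ⊆ᵇ Q = ∀ v → P v ≡ true → Q v ≡ true

count : ∀ {n} → (Fin n → Bool) → ℕ
count {zero}  P = 0
count {suc n} P = (if P F.zero then 1 else 0) ℕ.+ count (P ∘ F.suc)

length-filter-tabulate : ∀ {n m} (g : Fin n → Fin m) (P : Fin m → Bool) →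
  length (filter (BoolP.T? ∘ P) (tabulate g)) ≡ count (P ∘ g)
length-filter-tabulate {zero}  g P = refl
length-filter-tabulate {suc n} g P with P (g F.zero)
... | true  = cong suc (length-filter-tabulate (g ∘ F.suc) P)
... | false = length-filter-tabulate (g ∘ F.suc) P

countV≡count : ∀ {n} (P : Fin n → Bool) → countV P ≡ count P
countV≡count = length-filter-tabulate id

count-mono : ∀ {n} (P Q : Fin n → Bool) → P ⊆ᵇ Q → count P ℕ.≤ count Q
count-mono {zero}  P Q P⊆Q = z≤n
count-mono {suc n} P Q P⊆Q with P F.zero in eP | Q F.zero in eQ
... | true  | true  = s≤s (count-mono (P ∘ F.suc) (Q ∘ F.suc) (P⊆Q ∘ F.suc))
... | true  | false with () ← trans (≡.sym (P⊆Q F.zero eP)) eQ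
... | false | true  = ℕP.m≤n⇒m≤1+n (count-mono (P ∘ F.suc) (Q ∘ F.suc) (P⊆Q ∘ F.suc))
... | false | false = count-mono (P ∘ F.suc) (Q ∘ F.suc) (P⊆Q ∘ F.suc)

count-mono-< : ∀ {n} (P Q : Fin n → Bool) → P ⊆ᵇ Q →
  (w : Fin n) → Q w ≡ true → P w ≡ false → count P ℕ.< count Q
count-mono-< {suc n} P Q P⊆Q F.zero Qw Pw rewrite Qw | Pw =
  s≤s (count-mono (P ∘ F.suc) (Q ∘ F.suc) (P⊆Q ∘ F.suc))
count-mono-< {suc n} P Q P⊆Q (F.suc w) Qw Pw with P F.zero in eP | Q F.zero in eQ
... | true  | true  = s≤s (count-mono-< (P ∘ F.suc) (Q ∘ F.suc) (P⊆Q ∘ F.suc) w Qw Pw)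
... | true  | false with () ← trans (≡.sym (P⊆Q F.zero eP)) eQ
... | false | true  = ℕP.m≤n⇒m≤1+n (count-mono-< (P ∘ F.suc) (Q ∘ F.suc) (P⊆Q ∘ F.suc) w Qw Pw)
... | false | false = count-mono-< (P ∘ F.suc) (Q ∘ F.suc) (P⊆Q ∘ F.suc) w Qw Pw

count-pos : ∀ {n} (P : Fin n → Bool) (b : Fin n) → P b ≡ true → 1 ℕ.≤ count P
count-pos P F.zero Pb rewrite Pb = s≤s z≤n
count-pos P (F.suc b) Pb with P F.zero
... | true  = s≤s z≤n
... | false = count-pos (P ∘ F.suc) b Pb

count-≥2 : ∀ {n} (P : Fin n → Bool) (a b : Fin n) →
  P a ≡ true → P b ≡ true → a ≢ b → 2 ℕ.≤ count P
count-≥2 P a b Pa Pb a≢b =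
  ℕP.≤-trans (s≤s (count-pos P-a b P-a[b])) (count-mono-< P-a P P-a⊆P a Pa P-a[a])
  where
  P-a : _ → Bool
  P-a v = P v ∧ not ⌊ a ≟ v ⌋

  P-a⊆P : P-a ⊆ᵇ P
  P-a⊆P v e with P v
  ... | true  = refl
  ... | false = e

  P-a[a] : P-a a ≡ false
  P-a[a] with a ≟ a
  ... | yes _  = BoolP.∧-zeroʳ (P a)
  ... | no a≢a = ⊥-elim (a≢a refl)

  P-a[b] : P-a b ≡ true
  P-a[b] with a ≟ b
  ... | yes a≡b = ⊥-elim (a≢b a≡b)
  ... | no _ rewrite Pb = refl

sumℤ≤1 : ∀ {n} (f : Fin n → ℤ) (y : Fin n) →
  (∀ z → z ≢ y → f z ℤ.≤ + 0) → f y ℤ.≤ + 1 → sumℤ f ℤ.≤ + 1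
sumℤ≤1 f y f≤0 fy≤1 =
  subst (ℤ._≤ + 1) (≡.sym (cong (foldr _+_ (+ 0)) (ListP.map-tabulate id f)))
        (sum≤1 f y f≤0 fy≤1)
  where
  sum : ∀ {n} → (Fin n → ℤ) → ℤ
  sum f = foldr _+_ (+ 0) (tabulate f)

  sum≤0 : ∀ {n} (f : Fin n → ℤ) → (∀ z → f z ℤ.≤ + 0) → sum f ℤ.≤ + 0
  sum≤0 {zero}  f f≤0 = ℤP.≤-refl
  sum≤0 {suc n} f f≤0 = ℤP.+-mono-≤ (f≤0 F.zero) (sum≤0 (f ∘ F.suc) (f≤0 ∘ F.suc))

  sum≤1 : ∀ {n} (f : Fin n → ℤ) (y : Fin n) →
    (∀ z → z ≢ y → f z ℤ.≤ + 0) → f y ℤ.≤ + 1 → sum f ℤ.≤ + 1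
  sum≤1 {suc n} f F.zero f≤0 fy≤1 =
    ℤP.+-mono-≤ fy≤1 (sum≤0 (f ∘ F.suc) (λ z → f≤0 (F.suc z) λ ()))
  sum≤1 {suc n} f (F.suc y) f≤0 fy≤1 =
    ℤP.+-mono-≤ (f≤0 F.zero λ ())
      (sum≤1 (f ∘ F.suc) y (λ z z≢y → f≤0 (F.suc z) (z≢y ∘ FP.suc-injective)) fy≤1)

-- a - b + 1 - 0 is the summand of a cdeg sum with l = 0 at a neighbour z, for a = d_K(z), b = d_H(z).

summand≡ : ∀ a b → + a - + b + + 1 - + 0 ≡ (a ℕ.+ 1) ⊖ b
summand≡ a b = begin
  + a - + b + + 1 - + 0 ≡⟨ ℤP.+-identityʳ _ ⟩
  + a - + b + + 1       ≡⟨ cong (_+ + 1) (ℤP.[+m]-[+n]≡m⊖n a b) ⟩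
  a ⊖ b + + 1           ≡⟨ ℤP.distribˡ-⊖-+-pos 1 a b ⟩
  (a ℕ.+ 1) ⊖ b         ∎
  where open ≡-Reasoning

summand≤0 : ∀ a b → a ℕ.< b → + a - + b + + 1 - + 0 ℤ.≤ + 0
summand≤0 a b a<b rewrite summand≡ a b =
  subst ((a ℕ.+ 1) ⊖ b ℤ.≤_) (ℤP.n⊖n≡0 b)
    (ℤP.⊖-monoˡ-≤ b (subst (ℕ._≤ b) (ℕP.+-comm 1 a) a<b))

summand≤1 : ∀ a b → a ℕ.≤ b → + a - + b + + 1 - + 0 ℤ.≤ + 1
summand≤1 a b a≤b rewrite summand≡ a b =
  subst ((a ℕ.+ 1) ⊖ b ℤ.≤_)
    (trans (ℤP.⊖-≥ (ℕP.m≤m+n a 1)) (cong +_ (ℕP.m+n∸m≡n a 1)))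
    (ℤP.⊖-monoʳ-≥-≤ (a ℕ.+ 1) a≤b)

Isolated : ∀ {n} → SimpleGraph n → Fin n → Set
Isolated K z = ∀ w → adj K z w ≡ false

Deficient : ∀ {n} → SimpleGraph n → SimpleGraph n → Fin n → Set
Deficient H K z = deg K z ℕ.< deg H z

CdegZeroEdge : ∀ {n} → SimpleGraph n → SimpleGraph n → Set
CdegZeroEdge H K = ∃ λ x → ∃ λ y → adj K x y ≡ true × IsCdeg H K x y 0

adj-isolated : ∀ {n} (K : SimpleGraph n) {x z} → adj K x z ≡ true → ¬ Isolated K z
adj-isolated K {x} {z} xz z-iso with () ← trans (≡.sym xz) (trans (SimpleGraph.sym K x z) (z-iso x))

module CdegZero {n} (H K : SimpleGraph n) (K⊆H : K ⊆G H) where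

  deg-mono : ∀ z → deg K z ℕ.≤ deg H z
  deg-mono z rewrite countV≡count (adj K z) | countV≡count (adj H z) =
    count-mono (adj K z) (adj H z) (K⊆H z)

  deficient-if-edge-missing : ∀ {z w} → adj H z w ≡ true → adj K z w ≡ false → Deficient H K z
  deficient-if-edge-missing {z} {w} Hzw Kzw
    rewrite countV≡count (adj K z) | countV≡count (adj H z) =
    count-mono-< (adj K z) (adj H z) (K⊆H z) w Hzw Kzw

  cdeg≡0 : ∀ {x y} → adj K x y ≡ true →
    (∀ z → adj K x z ≡ true → z ≢ y → Deficient H K z) → IsCdeg H K x y 0
  cdeg≡0 {x} {y} xy others-deficient = condition , λ _ ()
    where
    condition : CdegCond H K x y 0
    condition Z Z⊆N[x] Zy = sumℤ≤1 _ y summand-others summand-y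
      where
      summand-others : ∀ z → z ≢ y →
        (if Z z then + deg K z - + deg H z + + μ K x z - + 0 else + 0) ℤ.≤ + 0
      summand-others z z≢y with Z z in Zz
      ... | false = ℤP.≤-refl
      ... | true rewrite Z⊆N[x] z Zz =
        summand≤0 (deg K z) (deg H z) (others-deficient z (Z⊆N[x] z Zz) z≢y)

      summand-y : (if Z y then + deg K y - + deg H y + + μ K x y - + 0 else + 0) ℤ.≤ + 1
      summand-y rewrite Zy | xy = summand≤1 (deg K y) (deg H y) (deg-mono y)

  edge-with-cdeg≡0 : ∀ {x w} → adj K x w ≡ true →
    (∀ z z′ → adj K x z ≡ true → adj K x z′ ≡ true →
       ¬ Deficient H K z → ¬ Deficient H K z′ → z ≡ z′) →
    CdegZeroEdge H K
  edge-with-cdeg≡0 {x} {w} xw unique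
    with FP.any? (λ z → (adj K x z BoolP.≟ true) ×-dec ¬? (deg K z ℕ.<? deg H z))
  ... | yes (y , xy , ¬def-y) = x , y , xy , cdeg≡0 xy λ z xz z≢y →
          decidable-stable (deg K z ℕ.<? deg H z) λ ¬def-z → z≢y (unique z y xz xy ¬def-z ¬def-y)
  ... | no none = x , w , xw , cdeg≡0 xw λ z xz _ →
          decidable-stable (deg K z ℕ.<? deg H z) λ ¬def-z → none (z , xz , ¬def-z)

module QueueWalk {n} (B K : SimpleGraph n) (K⊆B : K ⊆G B) (Q : Queue B) where

  open CdegZero B K K⊆B

  IsolatedUpTo : ℕ → Set
  IsolatedUpTo j = ∀ m → 1 ℕ.≤ m → m ℕ.≤ j → Isolated K (u Q m)

  isolatedUpTo-suc : ∀ {j} → IsolatedUpTo j → Isolated K (u Q (suc j)) → IsolatedUpTo (suc j)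
  isolatedUpTo-suc iso u-iso m 1≤m m≤1+j with ℕP.m≤n⇒m<n∨m≡n m≤1+j
  ... | inj₁ (s≤s m≤j) = iso m 1≤m m≤j
  ... | inj₂ refl      = u-iso

  isolated-or-deficient : ∀ j → j ℕ.≤ q Q → IsolatedUpTo j →
    ∀ z → S Q j z ≡ true → Isolated K z ⊎ Deficient B K z
  isolated-or-deficient zero _ _ z S₀z with () ← trans (≡.sym (S0 Q z)) S₀z
  isolated-or-deficient (suc j) j<q iso z Sz
    rewrite Sstep Q (suc j) (s≤s z≤n) j<q z
    with adj B (u Q (suc j)) z in Bxz | u Q (suc j) ≟ z
  ... | true  | _        = inj₂ (deficient-if-edge-missing
                             (trans (SimpleGraph.sym B z _) Bxz)
                             (trans (SimpleGraph.sym K z _) (iso (suc j) (s≤s z≤n) ℕP.≤-refl z)))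
  ... | false | yes refl = inj₁ (iso (suc j) (s≤s z≤n) ℕP.≤-refl)
  ... | false | no _     = isolated-or-deficient j (ℕP.<⇒≤ j<q)
                             (λ m 1≤m m≤j → iso m 1≤m (ℕP.m≤n⇒m≤1+n m≤j)) z Sz

  neighbour-deficient : ∀ {j x z} → j ℕ.≤ q Q → IsolatedUpTo j →
    adj K x z ≡ true → S Q j z ≡ true → Deficient B K z
  neighbour-deficient {j} {z = z} j≤q iso xz Sz with isolated-or-deficient j j≤q iso z Sz
  ... | inj₁ z-iso = ⊥-elim (adj-isolated K xz z-iso)
  ... | inj₂ z-def = z-def

  new-neighbour-unique : ∀ {j z z′} → suc j ℕ.≤ q Q →
    adj K (u Q (suc j)) z ≡ true → adj K (u Q (suc j)) z′ ≡ true →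
    S Q j z ≡ false → S Q j z′ ≡ false → z ≡ z′
  new-neighbour-unique {j} {z} {z′} j<q xz xz′ Sz Sz′ with z ≟ z′
  ... | yes z≡z′ = z≡z′
  ... | no z≢z′  = ⊥-elim (ℕP.<⇒≱ (s≤s (s≤s z≤n))
                     (ℕP.≤-trans (count-≥2 New z z′ (new xz Sz) (new xz′ Sz′) z≢z′) at-most-one))
    where
    x = u Q (suc j)

    New : Fin n → Bool
    New v = S Q (suc j) v ∧ not (S Q j v ∨ ⌊ x ≟ v ⌋)

    at-most-one : count New ℕ.≤ 1
    at-most-one = subst (ℕ._≤ 1) (countV≡count New) (extra Q (suc j) (s≤s z≤n) j<q)

    new : ∀ {v} → adj K x v ≡ true → S Q j v ≡ false → New v ≡ true
    new {v} xv Sv with x ≟ v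
    ... | yes refl with () ← trans (≡.sym xv) (irrefl K x)
    ... | no _ rewrite Sstep Q (suc j) (s≤s z≤n) j<q v | K⊆B x v xv | Sv = refl

  walk : ∀ j → j ℕ.≤ q Q → IsolatedUpTo j ⊎ CdegZeroEdge B K
  walk zero    _ = inj₁ λ m 1≤m m≤0 → ⊥-elim (ℕP.<⇒≱ 1≤m m≤0)
  walk (suc j) j<q with walk j (ℕP.<⇒≤ j<q)
  ... | inj₂ edge = inj₂ edge
  ... | inj₁ iso with FP.any? (λ w → adj K (u Q (suc j)) w BoolP.≟ true)
  ... | no  no-edge   = inj₁ (isolatedUpTo-suc iso λ w → BoolP.¬-not λ xw → no-edge (w , xw))
  ... | yes (w , xw) = inj₂ (edge-with-cdeg≡0 xw λ z z′ xz xz′ ¬def-z ¬def-z′ →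
                         new-neighbour-unique j<q xz xz′ (outside xz ¬def-z) (outside xz′ ¬def-z′))
    where
    outside : ∀ {z} → adj K (u Q (suc j)) z ≡ true → ¬ Deficient B K z → S Q j z ≡ false
    outside xz ¬def = BoolP.¬-not λ Sz → ¬def (neighbour-deficient (ℕP.<⇒≤ j<q) iso xz Sz)

theorem3p6 : (n : ℕ) (B : SimpleGraph n) → HasFullQueue B → CfanAtMost B 0
theorem3p6 n B (Q , full) K K⊆B (_ , _ , xy) =
  let x , y , x~y , cdeg≡0 = cdeg-zero-edge in x , y , x~y , 0 , cdeg≡0 , z≤n
  where
  open CdegZero B K K⊆B
  open QueueWalk B K K⊆B Q

  cdeg-zero-edge : CdegZeroEdge B K
  cdeg-zero-edge with walk (q Q) ℕP.≤-refl
  ... | inj₂ edge = edge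
  ... | inj₁ iso  = edge-with-cdeg≡0 xy λ z _ xz _ ¬def-z _ →
                      ⊥-elim (¬def-z (neighbour-deficient ℕP.≤-refl iso xz (full z)))
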